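{- Let $k\ge2$, $1\le s\le k-1$, $p\ge1$ be integers and let $\mathcal{S}=\mathcal{S}(k,s,p)$ be the sunflower with seed set $S$ and petal vertex sets $P_1,\dots,P_p$, with its vertices labelled by $[n]$, $n=s+p(k-s)$. Let $d$ be a positive integer with $k\mid d$, and let $f\in\mathcal{F}_d$ be such that $H_f=\mathcal{S}$ and $D_f$ is Eulerian. Then: (a) $\deg^+(v)=\deg^-(v)$ for all $v\in V(D_f)$, where $\deg^{+}$, $\deg^-$ denote out- and in-degree in $D_f$; (b) for each $v\in S$ and each $i\in[p]$ there is a nonnegative integer $q_{vi}$ such that $\{v\}\xrightarrow{q_{vi}}P_i$ in $D_f$; (c) for each $i\in[p]$ there is a positive integer $m_i$ such that $P_i\xrightarrow{m_i}S\cup P_i$ in $D_f$; (d) if $s\ge2$, then $S\xrightarrow{d/k}S$ in $D_f$.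
   Context: The sunflower $\mathcal{S}(k,s,p)$ has vertex set $S\cup P_1\cup\cdots\cup P_p$ (pairwise disjoint), $|S|=s$, $|P_i|=k-s$, and edge set $\{S\cup P_i:i\in[p]\}$. For a $k$-uniform hypergraph $H=(V,E)$ with $V=[n]$, let $\mathcal{F}_d$ be the set of $d$-tuples $f=(i_1\alpha_1,\dots,i_d\alpha_d)$ with $1\le i_1\le\cdots\le i_d\le n$, $\alpha_j\in[n]^{k-1}$, such that for each $j$ the $k$ entries of the $k$-tuple $i_j\alpha_j$ form an edge of $H$ (a "rooted edge" with root $i_j$). $H_f$ is the hypergraph whose vertices are all entries of the $i_j\alpha_j$ and whose edges are the sets underlying the $i_j\alpha_j$. $D_f$ is the multi-digraph on $V(H_f)$ whose arc multiset is, over all $j$, the arcs $(i_j,v_1),\dots,(i_j,v_{k-1})$ where $\alpha_j=v_1\cdots v_{k-1}$. A multi-digraph is Eulerian if it is connected and every vertex has in-degree equal to out-degree. For vertex sets $V,U$ and a nonnegative integer $m$, the notation $V\xrightarrow{m}U$ means that from each $v\in V$ to each vertex of $U\setminus\{v\}$ there is an arc of multiplicity exactly $m$ (multiplicity $0$ meaning no arc). -}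

module Defs where

open import Data.Nat using (ℕ; zero; suc; _+_; _*_; _∸_; _<_)
open import Data.Fin using (Fin; _≟_)
import Data.Fin as F
open import Data.Sum using (_⊎_; inj₁; inj₂)
open import Data.Product using (Σ; ∃; ∃-syntax; _×_; _,_)
open import Data.Bool using (if_then_else_)
open import Relation.Nullary.Decidable using (⌊_⌋)
open import Relation.Binary.PropositionalEquality using (_≡_; _≢_)
open import Relation.Binary.Construct.Closure.ReflexiveTransitive using (Star)
open import Function.Bundles using (_⤖_; Bijection; _⇔_)

∑ : ∀ {m} → (Fin m → ℕ) → ℕ
∑ {zero}  g = 0
∑ {suc m} g = g F.zero + ∑ (λ i → g (F.suc i))

-- Abstract vertex set of the sunflower S(k,s,p):
-- seed vertices  inj₁ a  (a : Fin s),  petal vertices  inj₂ (i , b)  (i : Fin p, b : Fin (k ∸ s)).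
SunV : ℕ → ℕ → ℕ → Set
SunV k s p = Fin s ⊎ (Fin p × Fin (k ∸ s))

Labelling : ℕ → ℕ → ℕ → ℕ → Set
Labelling n k s p = Fin n ⤖ SunV k s p

module Sunflower {n k s p : ℕ} (lab : Labelling n k s p) where
  open Bijection lab using (to)

  InS : Fin n → Set
  InS v = ∃[ a ] (to v ≡ inj₁ a)

  InP : Fin p → Fin n → Set
  InP i v = ∃[ b ] (to v ≡ inj₂ (i , b))

  InEdge : Fin p → Fin n → Set
  InEdge i v = InS v ⊎ InP i v

-- A d-tuple f = (i_1 α_1, …, i_d α_d) of k-tuples over [n], with roots i_j
-- and tails α_j ∈ [n]^(k-1).
record Tuples (n k d : ℕ) : Set where
  field
    root : Fin d → Fin n
    tail : Fin d → Fin (k ∸ 1) → Fin n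

module OfTuples {n k d : ℕ} (f : Tuples n k d) where
  open Tuples f

  Entry : Fin d → Fin n → Set
  Entry j v = (root j ≡ v) ⊎ (∃[ l ] (tail j l ≡ v))

  mult : Fin n → Fin n → ℕ
  mult u v = ∑ (λ j → ∑ (λ l →
               if ⌊ root j ≟ u ⌋ then (if ⌊ tail j l ≟ v ⌋ then 1 else 0) else 0))

  outdeg : Fin n → ℕ
  outdeg u = ∑ (λ v → mult u v)

  indeg : Fin n → ℕ
  indeg v = ∑ (λ u → mult u v)

  Adj : Fin n → Fin n → Set
  Adj u v = (0 < mult u v) ⊎ (0 < mult v u)

  Connected : Set
  Connected = ∀ u v → Star Adj u v

  Eulerian : Set
  Eulerian = Connected × (∀ v → indeg v ≡ outdeg v)

  Arrow : (Fin n → Set) → ℕ → (Fin n → Set) → Set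
  Arrow V m U = ∀ v u → V v → U u → u ≢ v → mult v u ≡ m

module _ {n k s p d : ℕ} (lab : Labelling n k s p) (f : Tuples n k d) where
  open Sunflower lab
  open OfTuples f
  open Tuples f

  InFd : Set
  InFd = (∀ j j' → j F.≤ j' → root j F.≤ root j')
       × (∀ j → ∃[ i ] (∀ v → Entry j v ⇔ InEdge i v))

  -- H_f = S: the vertex set of H_f is all of [n] and every edge of S underlies some tuple
  -- (that every tuple underlies an edge of S is part of InFd).
  HfIsSunflower : Set
  HfIsSunflower = (∀ v → ∃[ j ] Entry j v)
                × (∀ i → ∃[ j ] (∀ v → Entry j v ⇔ InEdge i v))

{-# OPTIONS --safe #-}
-- The k entries of a tuple cover the k vertices of its edge, so each tuple contains every vertex of
-- its edge exactly once. If r(v) tuples are rooted at v, then v has out-degree r(v)(k − 1) and occurs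
-- r(v) + indeg(v) times in f; degree balance makes this r(v)k. For u ≠ w, the multiplicity of the arc
-- u → w is the number of tuples rooted at u that contain w. Seed vertices lie in all d tuples, so
-- r = d/k on S; two vertices of one petal lie in the same tuples, so r is constant on each petal and
-- they receive equally many arcs from every other vertex; and every tuple rooted at u contains S, and
-- all of P_i when u ∈ P_i, so the arcs in (c) and (d) have multiplicity r(u).
module Submission where

open import Defs
open import Data.Nat using (ℕ; _≤_; _<_; _∸_; _+_; _*_)
import Data.Nat.Divisibility
open import Data.Nat.Divisibility using (_∣_)
open Data.Nat.Divisibility._∣_ using (quotient)
open import Data.Fin using (Fin)
open import Data.Sum using (_⊎_)
open import Data.Product using (∃-syntax; _×_)
open import Relation.Binary.PropositionalEquality using (_≡_)

import Data.Nat.Properties as NP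
open import Algebra.Properties.Semiring.Sum NP.+-*-semiring
  using (sum; sum-cong-≗; sum-replicate-zero; ∑-comm; ∑-distrib-+; *-distribˡ-sum; *-distribʳ-sum)
open import Data.Bool using (if_then_else_)
open import Data.Empty using (⊥-elim)
import Data.Fin as F
import Data.Fin.Properties as FP
open import Data.Nat using (zero; suc; s≤s)
open import Data.Product using (∃; _,_; proj₁; proj₂)
open import Data.Sum using (inj₁; inj₂)
open import Function using (_∘_; id)
open import Function.Bundles using (Bijection; Equivalence; _⇔_)
open import Function.Definitions using (Injective)
open import Relation.Nullary using (¬_; yes; no)
open import Relation.Nullary.Decidable using (⌊_⌋)
open import Relation.Binary.PropositionalEquality
  using (refl; sym; trans; cong; cong₂; subst; _≢_; module ≡-Reasoning)

∑≡sum : ∀ {m} (g : Fin m → ℕ) → ∑ g ≡ sum g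
∑≡sum {zero}  g = refl
∑≡sum {suc m} g = cong (g F.zero +_) (∑≡sum (g ∘ F.suc))

sum-const : ∀ m c → sum {m} (λ _ → c) ≡ m * c
sum-const zero    c = refl
sum-const (suc m) c = cong (c +_) (sum-const m c)

≤-sum : ∀ {m} (g : Fin m → ℕ) i → g i ≤ sum g
≤-sum g F.zero    = NP.m≤m+n _ _
≤-sum g (F.suc i) = NP.≤-trans (≤-sum (g ∘ F.suc) i) (NP.m≤n+m _ _)

δ : ∀ {n} → Fin n → Fin n → ℕ
δ x y = if ⌊ x F.≟ y ⌋ then 1 else 0

module _ {n : ℕ} where

  δ-≡ : {x y : Fin n} → x ≡ y → δ x y ≡ 1
  δ-≡ {x} {y} x≡y with x F.≟ y
  ... | yes _   = refl
  ... | no  x≢y = ⊥-elim (x≢y x≡y)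

  δ-≢ : {x y : Fin n} → x ≢ y → δ x y ≡ 0
  δ-≢ {x} {y} x≢y with x F.≟ y
  ... | yes x≡y = ⊥-elim (x≢y x≡y)
  ... | no  _   = refl

  δ-comm : (x y : Fin n) → δ x y ≡ δ y x
  δ-comm x y with x F.≟ y
  ... | yes x≡y = sym (δ-≡ (sym x≡y))
  ... | no  x≢y = sym (δ-≢ (x≢y ∘ sym))

  if-≟≡δ* : (x y : Fin n) (c : ℕ) → (if ⌊ x F.≟ y ⌋ then c else 0) ≡ δ x y * c
  if-≟≡δ* x y c with x F.≟ y
  ... | yes _ = sym (NP.+-identityʳ c)
  ... | no  _ = refl

  δ*-absorb : {u w : Fin n} → w ≢ u → ∀ x c → δ x u * (δ x w + c) ≡ δ x u * c
  δ*-absorb {u} w≢u x c with x F.≟ u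
  ... | yes refl = cong (λ t → t + c + 0) (δ-≢ (w≢u ∘ sym))
  ... | no  _    = refl

  δ*≡δ : ∀ (x u : Fin n) {c} → (x ≡ u → c ≡ 1) → δ x u * c ≡ δ x u
  δ*≡δ x u c≡1 with x F.≟ u
  ... | yes x≡u = cong (_+ 0) (c≡1 x≡u)
  ... | no  _   = refl

count : ∀ {m n} → (Fin m → Fin n) → Fin n → ℕ
count g v = sum (λ l → δ (g l) v)

module _ {m n : ℕ} where

  count-∉ : (g : Fin m → Fin n) {v : Fin n} → (∀ l → g l ≢ v) → count g v ≡ 0
  count-∉ g g≢v = trans (sum-cong-≗ (δ-≢ ∘ g≢v)) (sum-replicate-zero m)

  count-positive : (g : Fin m → Fin n) {v : Fin n} → (∃ λ l → g l ≡ v) → 1 ≤ count g v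
  count-positive g (l , gl≡v) = subst (_≤ count g _) (δ-≡ gl≡v) (≤-sum (λ l → δ (g l) _) l)

count-injective : ∀ {m n} (g : Fin m → Fin n) {v} → Injective _≡_ _≡_ g → ∀ l → g l ≡ v → count g v ≡ 1
count-injective {suc m} g g-inj F.zero g0≡v =
  cong₂ _+_ (δ-≡ g0≡v) (count-∉ (g ∘ F.suc) (λ l gl≡v → FP.0≢1+n (g-inj (trans g0≡v (sym gl≡v)))))
count-injective {suc m} g g-inj (F.suc l) gl≡v =
  cong₂ _+_ (δ-≢ (λ g0≡v → FP.0≢1+n (g-inj (trans g0≡v (sym gl≡v)))))
            (count-injective (g ∘ F.suc) (FP.suc-injective ∘ g-inj) l gl≡v)

sum-δ : ∀ {n} (x : Fin n) → sum (δ x) ≡ 1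
sum-δ x = trans (sum-cong-≗ (δ-comm x)) (count-injective id id x refl)

sum-count : ∀ {m n} (g : Fin m → Fin n) → sum (count g) ≡ m
sum-count {m} g = begin
  sum (λ v → sum (λ l → δ (g l) v)) ≡⟨ ∑-comm (λ v l → δ (g l) v) ⟩
  sum (λ l → sum (δ (g l)))         ≡⟨ sum-cong-≗ (sum-δ ∘ g) ⟩
  sum {m} (λ _ → 1)                 ≡⟨ sum-const m 1 ⟩
  m * 1                             ≡⟨ NP.*-identityʳ m ⟩
  m                                 ∎
  where open ≡-Reasoning

Covers : ∀ {m m'} {A : Set} → (Fin m → A) → (Fin m' → A) → Set
Covers g φ = ∀ x → ∃ λ l → g l ≡ φ x

module _ {A : Set} where

  covers-trans : ∀ {m m' m''} {g : Fin m → A} {h : Fin m' → A} {φ : Fin m'' → A} →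
                 Covers g h → Covers h φ → Covers g φ
  covers-trans g⊒h h⊒φ x with h⊒φ x
  ... | l , hl≡φx with g⊒h l
  ... | l' , gl'≡hl = l' , trans gl'≡hl hl≡φx

  covers-injective⇒≤ : ∀ {m m'} {g : Fin m → A} {φ : Fin m' → A} →
                       Injective _≡_ _≡_ φ → Covers g φ → m' ≤ m
  covers-injective⇒≤ {g = g} {φ} φ-inj g⊒φ = FP.injective⇒≤ pick-injective
    where
    pick-injective : Injective _≡_ _≡_ (proj₁ ∘ g⊒φ)
    pick-injective {x} {y} eq =
      φ-inj (trans (sym (proj₂ (g⊒φ x))) (trans (cong g eq) (proj₂ (g⊒φ y))))

  punchIn-covers : ∀ {m} (g : Fin (suc m) → A) {a b} → g a ≡ g b → a ≢ b → Covers (g ∘ F.punchIn b) g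
  punchIn-covers g {a} {b} ga≡gb a≢b x with x F.≟ b
  ... | yes refl = F.punchOut (a≢b ∘ sym) , trans (cong g (FP.punchIn-punchOut _)) ga≡gb
  ... | no  x≢b  = F.punchOut (x≢b ∘ sym) , cong g (FP.punchIn-punchOut _)

  covers⇒injective : ∀ {m m'} {g : Fin m → A} {φ : Fin m' → A} →
                     m ≤ m' → Injective _≡_ _≡_ φ → Covers g φ → Injective _≡_ _≡_ g
  covers⇒injective {suc m} {m'} {g = g} m<m' φ-inj g⊒φ {a} {b} ga≡gb with a F.≟ b
  ... | yes a≡b = a≡b
  ... | no  a≢b = ⊥-elim (NP.<⇒≱ (s≤s m'≤m) m<m')
    where
    m'≤m : m' ≤ m
    m'≤m = covers-injective⇒≤ φ-inj (covers-trans (punchIn-covers g ga≡gb a≢b) g⊒φ)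

module TupleDegrees {n k' d : ℕ} (f : Tuples n (suc k') d) where
  open Tuples f
  open OfTuples f

  entries : Fin d → Fin (suc k') → Fin n
  entries j F.zero    = root j
  entries j (F.suc l) = tail j l

  Entry⇒entries : ∀ {j v} → Entry j v → ∃ λ l → entries j l ≡ v
  Entry⇒entries (inj₁ root≡v)       = F.zero , root≡v
  Entry⇒entries (inj₂ (l , tail≡v)) = F.suc l , tail≡v

  entries⇒Entry : ∀ {j v} → (∃ λ l → entries j l ≡ v) → Entry j v
  entries⇒Entry (F.zero  , root≡v) = inj₁ root≡v
  entries⇒Entry (F.suc l , tail≡v) = inj₂ (l , tail≡v)

  occ : Fin d → Fin n → ℕ
  occ j = count (entries j)

  occurrences : Fin n → ℕ
  occurrences v = sum (λ j → occ j v)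

  rootCount : Fin n → ℕ
  rootCount u = sum (λ j → δ (root j) u)

  Balanced : Set
  Balanced = ∀ v → indeg v ≡ outdeg v

  open ≡-Reasoning

  mult≡ : ∀ u v → mult u v ≡ sum (λ j → δ (root j) u * count (tail j) v)
  mult≡ u v = begin
    mult u v
      ≡⟨ ∑≡sum (λ j → ∑ (guarded j)) ⟩
    sum (λ j → ∑ (guarded j))
      ≡⟨ sum-cong-≗ (λ j → ∑≡sum (guarded j)) ⟩
    sum (λ j → sum (guarded j))
      ≡⟨ sum-cong-≗ (λ j → sum-cong-≗ (λ l → if-≟≡δ* (root j) u (δ (tail j l) v))) ⟩
    sum (λ j → sum (λ l → δ (root j) u * δ (tail j l) v))
      ≡⟨ sum-cong-≗ (λ j → *-distribˡ-sum (δ (root j) u) (λ l → δ (tail j l) v)) ⟨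
    sum (λ j → δ (root j) u * count (tail j) v)
      ∎
    where
    guarded : Fin d → Fin k' → ℕ
    guarded j l = if ⌊ root j F.≟ u ⌋ then δ (tail j l) v else 0

  outdeg≡ : ∀ u → outdeg u ≡ rootCount u * k'
  outdeg≡ u = begin
    outdeg u
      ≡⟨ ∑≡sum (mult u) ⟩
    sum (mult u)
      ≡⟨ sum-cong-≗ (mult≡ u) ⟩
    sum (λ v → sum (λ j → δ (root j) u * count (tail j) v))
      ≡⟨ ∑-comm (λ v j → δ (root j) u * count (tail j) v) ⟩
    sum (λ j → sum (λ v → δ (root j) u * count (tail j) v))
      ≡⟨ sum-cong-≗ (λ j → *-distribˡ-sum (δ (root j) u) (count (tail j))) ⟨
    sum (λ j → δ (root j) u * sum (count (tail j)))
      ≡⟨ sum-cong-≗ (λ j → cong (δ (root j) u *_) (sum-count (tail j))) ⟩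
    sum (λ j → δ (root j) u * k')
      ≡⟨ *-distribʳ-sum k' (λ j → δ (root j) u) ⟨
    rootCount u * k'
      ∎

  indeg≡ : ∀ v → indeg v ≡ sum (λ j → count (tail j) v)
  indeg≡ v = begin
    indeg v
      ≡⟨ ∑≡sum (λ u → mult u v) ⟩
    sum (λ u → mult u v)
      ≡⟨ sum-cong-≗ (λ u → mult≡ u v) ⟩
    sum (λ u → sum (λ j → δ (root j) u * count (tail j) v))
      ≡⟨ ∑-comm (λ u j → δ (root j) u * count (tail j) v) ⟩
    sum (λ j → sum (λ u → δ (root j) u * count (tail j) v))
      ≡⟨ sum-cong-≗ (λ j → *-distribʳ-sum (count (tail j) v) (δ (root j))) ⟨
    sum (λ j → sum (δ (root j)) * count (tail j) v)
      ≡⟨ sum-cong-≗ (λ j → cong (_* count (tail j) v) (sum-δ (root j))) ⟩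
    sum (λ j → 1 * count (tail j) v)
      ≡⟨ sum-cong-≗ (λ j → NP.*-identityˡ (count (tail j) v)) ⟩
    sum (λ j → count (tail j) v)
      ∎

  occurrences≡ : Balanced → ∀ v → occurrences v ≡ rootCount v * suc k'
  occurrences≡ balanced v = begin
    sum (λ j → δ (root j) v + count (tail j) v)
      ≡⟨ ∑-distrib-+ (λ j → δ (root j) v) (λ j → count (tail j) v) ⟩
    rootCount v + sum (λ j → count (tail j) v)
      ≡⟨ cong (rootCount v +_) (indeg≡ v) ⟨
    rootCount v + indeg v
      ≡⟨ cong (rootCount v +_) (trans (balanced v) (outdeg≡ v)) ⟩
    rootCount v + rootCount v * k'
      ≡⟨ NP.*-suc (rootCount v) k' ⟨
    rootCount v * suc k'
      ∎

  mult≡occ : ∀ {u w} → w ≢ u → mult u w ≡ sum (λ j → δ (root j) u * occ j w)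
  mult≡occ {u} {w} w≢u =
    trans (mult≡ u w) (sum-cong-≗ (λ j → sym (δ*-absorb w≢u (root j) (count (tail j) w))))

  mult≡rootCount : ∀ {u w} → w ≢ u → (∀ j → root j ≡ u → occ j w ≡ 1) → mult u w ≡ rootCount u
  mult≡rootCount {u} {w} w≢u occ≡1 =
    trans (mult≡occ w≢u) (sum-cong-≗ (λ j → δ*≡δ (root j) u (occ≡1 j)))

  rootCount-positive : Balanced → ∀ {j v} → Entry j v → 1 ≤ rootCount v
  rootCount-positive balanced {j} {v} entry = NP.n≢0⇒n>0 λ rootCount≡0 →
    NP.n>0⇒n≢0 occurrences-positive (trans (occurrences≡ balanced v) (cong (_* suc k') rootCount≡0))
    where
    occurrences-positive : 1 ≤ occurrences v
    occurrences-positive = NP.≤-trans (count-positive (entries j) (Entry⇒entries entry))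
                                      (≤-sum (λ j → occ j v) j)

module SunflowerTuples {n k' s p d : ℕ} (lab : Labelling n (suc k') s p) (f : Tuples n (suc k') d)
                       (inFd : InFd lab f) where
  open Sunflower lab
  open Tuples f
  open OfTuples f
  open TupleDegrees f
  open Bijection lab using (to; strictlySurjective)

  seedOrPetal : Fin p → Fin s ⊎ Fin (suc k' ∸ s) → SunV (suc k') s p
  seedOrPetal i (inj₁ a) = inj₁ a
  seedOrPetal i (inj₂ b) = inj₂ (i , b)

  seedOrPetal-injective : ∀ i → Injective _≡_ _≡_ (seedOrPetal i)
  seedOrPetal-injective i {inj₁ a} {inj₁ .a} refl = refl
  seedOrPetal-injective i {inj₂ b} {inj₂ .b} refl = refl

  edgeVertex : Fin p → Fin (s + (suc k' ∸ s)) → SunV (suc k') s p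
  edgeVertex i = seedOrPetal i ∘ F.splitAt s

  edgeVertex-injective : ∀ i → Injective _≡_ _≡_ (edgeVertex i)
  edgeVertex-injective i {x} {y} eq = begin
    x                          ≡⟨ FP.join-splitAt s _ x ⟨
    F.join s _ (F.splitAt s x) ≡⟨ cong (F.join s _) (seedOrPetal-injective i eq) ⟩
    F.join s _ (F.splitAt s y) ≡⟨ FP.join-splitAt s _ y ⟩
    y                          ∎
    where open ≡-Reasoning

  InEdge-edgeVertex : ∀ i x {v} → to v ≡ edgeVertex i x → InEdge i v
  InEdge-edgeVertex i x to≡ with F.splitAt s x
  ... | inj₁ a = inj₁ (a , to≡)
  ... | inj₂ b = inj₂ (b , to≡)

  edgeOf : Fin d → Fin p
  edgeOf j = proj₁ (proj₂ inFd j)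

  Entry⇔InEdge : ∀ j v → Entry j v ⇔ InEdge (edgeOf j) v
  Entry⇔InEdge j = proj₂ (proj₂ inFd j)

  entries-cover-edge : ∀ j → Covers (to ∘ entries j) (edgeVertex (edgeOf j))
  entries-cover-edge j x with strictlySurjective (edgeVertex (edgeOf j) x)
  ... | v , to≡ with Entry⇒entries (Equivalence.from (Entry⇔InEdge j v) (InEdge-edgeVertex _ x to≡))
  ... | l , entry≡v = l , trans (cong to entry≡v) to≡

  entries-injective : ∀ j → Injective _≡_ _≡_ (entries j)
  entries-injective j eq = covers⇒injective (NP.m≤n+m∸n (suc k') s)
    (edgeVertex-injective (edgeOf j)) (entries-cover-edge j) (cong to eq)

  occ-InEdge : ∀ {j v} → InEdge (edgeOf j) v → occ j v ≡ 1
  occ-InEdge {j} {v} v∈edge with Entry⇒entries (Equivalence.from (Entry⇔InEdge j v) v∈edge)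
  ... | l , entry≡v = count-injective (entries j) (entries-injective j) l entry≡v

  occ-∉InEdge : ∀ {j v} → ¬ InEdge (edgeOf j) v → occ j v ≡ 0
  occ-∉InEdge {j} {v} v∉edge = count-∉ (entries j) λ l entry≡v →
    v∉edge (Equivalence.to (Entry⇔InEdge j v) (entries⇒Entry (l , entry≡v)))

  InP⇒edge≡ : ∀ {i i' u} → InP i u → InEdge i' u → i' ≡ i
  InP⇒edge≡ (b , to≡petal) (inj₁ (a , to≡seed)) with () ← trans (sym to≡seed) to≡petal
  InP⇒edge≡ (b , to≡petal) (inj₂ (b' , to≡petal'))
    with refl ← trans (sym to≡petal') to≡petal = refl

  InS⇒≢InP : ∀ {i u v} → InS v → InP i u → v ≢ u
  InS⇒≢InP (a , to≡seed) (b , to≡petal) refl with () ← trans (sym to≡seed) to≡petal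

  occ-petal : ∀ j {i u u'} → InP i u → InP i u' → occ j u ≡ occ j u'
  occ-petal j {i} u∈P u'∈P with edgeOf j F.≟ i
  ... | yes refl = trans (occ-InEdge (inj₂ u∈P)) (sym (occ-InEdge (inj₂ u'∈P)))
  ... | no  e≢i  =
    trans (occ-∉InEdge (e≢i ∘ InP⇒edge≡ u∈P)) (sym (occ-∉InEdge (e≢i ∘ InP⇒edge≡ u'∈P)))

  rootCount-petal : Balanced → ∀ {i u u'} → InP i u → InP i u' → rootCount u ≡ rootCount u'
  rootCount-petal balanced {u = u} {u'} u∈P u'∈P = NP.*-cancelʳ-≡ _ _ (suc k') (begin
    rootCount u * suc k'  ≡⟨ occurrences≡ balanced u ⟨
    occurrences u         ≡⟨ sum-cong-≗ (λ j → occ-petal j u∈P u'∈P) ⟩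
    occurrences u'        ≡⟨ occurrences≡ balanced u' ⟩
    rootCount u' * suc k' ∎)
    where open ≡-Reasoning

  rootCount-seed : Balanced → ∀ {u} → InS u → rootCount u * suc k' ≡ d
  rootCount-seed balanced {u} u∈S = begin
    rootCount u * suc k'  ≡⟨ occurrences≡ balanced u ⟨
    occurrences u         ≡⟨ sum-cong-≗ (λ j → occ-InEdge {j} (inj₁ u∈S)) ⟩
    sum {d} (λ _ → 1)     ≡⟨ sum-const d 1 ⟩
    d * 1                 ≡⟨ NP.*-identityʳ d ⟩
    d                     ∎
    where open ≡-Reasoning

  mult-from-petal : ∀ {i u w} → InP i u → InEdge i w → w ≢ u → mult u w ≡ rootCount u
  mult-from-petal {i} {u} {w} u∈P w∈edge w≢u = mult≡rootCount w≢u λ j root≡u →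
    occ-InEdge (subst (λ e → InEdge e w) (sym (edge≡i j root≡u)) w∈edge)
    where
    edge≡i : ∀ j → root j ≡ u → edgeOf j ≡ i
    edge≡i j root≡u = InP⇒edge≡ u∈P (Equivalence.to (Entry⇔InEdge j u) (inj₁ root≡u))

  mult-into-seed : ∀ {u w} → InS w → w ≢ u → mult u w ≡ rootCount u
  mult-into-seed w∈S w≢u = mult≡rootCount w≢u (λ j _ → occ-InEdge {j} (inj₁ w∈S))

  mult-into-petal : ∀ {i u w w'} → InP i w → InP i w' → w ≢ u → w' ≢ u → mult u w ≡ mult u w'
  mult-into-petal {u = u} {w} {w'} w∈P w'∈P w≢u w'≢u = begin
    mult u w                           ≡⟨ mult≡occ w≢u ⟩
    sum (λ j → δ (root j) u * occ j w)  ≡⟨ sum-cong-≗ (λ j → cong (δ (root j) u *_) (occ-petal j w∈P w'∈P)) ⟩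
    sum (λ j → δ (root j) u * occ j w') ≡⟨ mult≡occ w'≢u ⟨
    mult u w'                          ∎
    where open ≡-Reasoning

lemma3p2 : (k s p n d : ℕ) → 2 ≤ k → 1 ≤ s → s ≤ k ∸ 1 → 1 ≤ p
    → n ≡ s + p * (k ∸ s)
    → (lab : Labelling n k s p)
    → 1 ≤ d → (k∣d : k ∣ d)
    → (f : Tuples n k d)
    → InFd lab f → HfIsSunflower lab f → OfTuples.Eulerian f
    → (∀ v → OfTuples.outdeg f v ≡ OfTuples.indeg f v)
      × (∀ v (i : Fin p) → Sunflower.InS lab v →
           ∃[ q ] OfTuples.Arrow f (λ u → u ≡ v) q (Sunflower.InP lab i))
      × (∀ (i : Fin p) → ∃[ m ] (1 ≤ m ×
           OfTuples.Arrow f (Sunflower.InP lab i) m (Sunflower.InEdge lab i)))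
      × (2 ≤ s → OfTuples.Arrow f (Sunflower.InS lab) (quotient k∣d) (Sunflower.InS lab))
lemma3p2 (suc k') s p n d (s≤s _) _ s≤k' _ _ lab _ k∣d f inFd (covered , _) (_ , balanced) =
  sym ∘ balanced , seed→petal , petal→edge , λ _ → seed→seed
  where
  open Sunflower lab
  open OfTuples f
  open TupleDegrees f
  open SunflowerTuples lab f inFd

  petalVertex : Fin p → Fin n
  petalVertex i = proj₁ (Bijection.strictlySurjective lab (inj₂ (i , F.fromℕ< (NP.m<n⇒0<n∸m (s≤s s≤k')))))

  petalVertex∈P : ∀ i → InP i (petalVertex i)
  petalVertex∈P i = _ , proj₂ (Bijection.strictlySurjective lab _)

  seed→petal : ∀ v i → InS v → ∃[ q ] Arrow (λ u → u ≡ v) q (InP i)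
  seed→petal v i v∈S = mult v (petalVertex i) , λ { .v w refl w∈P w≢v →
    mult-into-petal w∈P (petalVertex∈P i) w≢v (InS⇒≢InP v∈S (petalVertex∈P i) ∘ sym) }

  petal→edge : ∀ i → ∃[ m ] (1 ≤ m × Arrow (InP i) m (InEdge i))
  petal→edge i = rootCount (petalVertex i) , rootCount-positive balanced (proj₂ (covered (petalVertex i))) ,
    λ u w u∈P w∈edge w≢u →
      trans (mult-from-petal u∈P w∈edge w≢u) (rootCount-petal balanced u∈P (petalVertex∈P i))

  seed→seed : Arrow InS (quotient k∣d) InS
  seed→seed u w u∈S w∈S w≢u = trans (mult-into-seed w∈S w≢u)
    (NP.*-cancelʳ-≡ _ _ (suc k') (trans (rootCount-seed balanced u∈S) (_∣_.equality k∣d)))
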